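{- Let $B=B'(p)$ and let $\beta_1:=\min\{\max\{z(s):s\in S\}:z\in B\cap\mathbb{Z}^S\}$ be the largest component of a max-minimizer of $B\cap\mathbb{Z}^S$. Then $$\beta_1=\max\left\{\left\lceil\frac{p(X)}{|X|}\right\rceil:\emptyset\ne X\subseteq S\right\}.$$
   Context: $S$ is a finite non-empty set; $p$ is a set-function on subsets of $S$ with values in $\mathbb{Z}\cup\{ -\infty\}$, $p(\emptyset)=0$, $p(S)$ finite, and supermodular: $p(X)+p(Y)\le p(X\cap Y)+p(X\cup Y)$ whenever $p(X),p(Y)$ are finite. $B'(p)=\{x\in\mathbb{R}^S:\widetilde x(S)=p(S),\ \widetilde x(Z)\ge p(Z)\ \forall Z\subset S\}$ with $\widetilde x(Z)=\sum_{s\in Z}x(s)$; it is a non-empty integral polyhedron. A max-minimizer of $B\cap\mathbb{Z}^S$ is an element whose largest component is as small as possible. -}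

module Defs where

open import Data.Nat using (ℕ; zero; suc)
open import Data.Integer as ℤ using (ℤ; +_; -_; _+_; _≤_; _/ℕ_)
open import Data.Fin using (Fin; zero; suc)
open import Data.Fin.Subset using (Subset; _∈_; _∩_; _∪_; ⊥; ⊤; Nonempty; ∣_∣)
open import Data.Vec using (lookup)
open import Data.Bool using (if_then_else_)
open import Data.Product using (Σ; ∃; _×_; _,_)
open import Relation.Binary.PropositionalEquality using (_≡_)

data ℤ∞ : Set where
  -∞  : ℤ∞
  fin : ℤ → ℤ∞

-- the ground set S is Fin n (non-empty means n = suc m)

sumOver : ∀ {n} → Subset n → (Fin n → ℤ) → ℤ
sumOver {zero}  Z x = + 0
sumOver {suc n} Z x =
  (if lookup Z zero then x zero else + 0)
  + sumOver {n} (Data.Vec.tail Z) (λ i → x (suc i))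
  where import Data.Vec

_≥∞_ : ℤ → ℤ∞ → Set
a ≥∞ -∞    = Data.Unit.⊤
  where import Data.Unit
a ≥∞ fin b = b ≤ a

record Admissible {n : ℕ} (p : Subset n → ℤ∞) : Set where
  field
    p-empty : p ⊥ ≡ fin (+ 0)
    p-S-finite : ∃ λ c → p ⊤ ≡ fin c
    supermodular : ∀ X Y a b → p X ≡ fin a → p Y ≡ fin b →
      Σ ℤ λ c → Σ ℤ λ d → p (X ∩ Y) ≡ fin c × p (X ∪ Y) ≡ fin d × a + b ≤ c + d

-- integer points of B'(p): x̃(S) = p(S), x̃(Z) ≥ p(Z) for every Z ⊂ S
-- (Z = S is also quantified over; that instance follows from the equality)
InB'ℤ : ∀ {n} → (Subset n → ℤ∞) → (Fin n → ℤ) → Set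
InB'ℤ p x = (p ⊤ ≡ fin (sumOver ⊤ x)) × (∀ Z → sumOver Z x ≥∞ p Z)

IsMaxComp : ∀ {n} → (Fin n → ℤ) → ℤ → Set
IsMaxComp z β = (∀ s → z s ≤ β) × (∃ λ s → z s ≡ β)

IsMinMaxComp : ∀ {n} → (Subset n → ℤ∞) → ℤ → Set
IsMinMaxComp p β =
  (∃ λ z → InB'ℤ p z × IsMaxComp z β) ×
  (∀ z γ → InB'ℤ p z → IsMaxComp z γ → β ≤ γ)

-- ⌈a / k⌉ for k > 0 (k = 0 never used)
ceilDiv : ℤ → ℕ → ℤ
ceilDiv a zero    = + 0
ceilDiv a (suc k) = - ((- a) /ℕ suc k)

ceilRatio : ∀ {n} → (Subset n → ℤ∞) → Subset n → ℤ∞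
ceilRatio p X with p X
... | -∞    = -∞
... | fin a = fin (ceilDiv a ∣ X ∣)

IsMaxRatio : ∀ {n} → (Subset n → ℤ∞) → ℤ → Set
IsMaxRatio p β =
  (∃ λ X → Nonempty X × ceilRatio p X ≡ fin β) ×
  (∀ X → Nonempty X → β ≥∞ ceilRatio p X)

-- β := max ⌈p(X)/|X|⌉ bounds max z from below for every z ∈ B'(p), because
-- p(X) ≤ z̃(X) ≤ |X| · max z. Conversely p(X) ≤ β|X| for all X, so the slack
-- p(W) − β|W| is supermodular and ≤ 0. Maximising the slack over the supersets of X
-- and adding back β|X| gives a finite supermodular q ≥ p with q(∅) = 0, q(S) = p(S)
-- and q − β|·| antitone. The greedy vector of q then lies in B'(p) and all its
-- components are ≤ β, so by the lower bound its largest component is exactly β.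
module Submission where

open import Defs
open import Data.Nat as ℕ using (ℕ; zero; suc)
import Data.Nat.Properties as ℕP
open import Data.Integer as ℤ using (ℤ; +_; -_; _+_; _-_; _*_; _≤_; _/ℕ_; _⊔_)
import Data.Integer.Properties as ℤP
import Data.Integer.DivMod as ℤDM
open import Algebra.Properties.CommutativeSemigroup ℤP.+-commutativeSemigroup
  using () renaming (interchange to +-interchange)
open import Data.Integer.Tactic.RingSolver using (solve-∀)
open import Data.Fin using (Fin; zero; suc)
import Data.Fin.Properties as FinP
open import Data.Fin.Subset
  using (Subset; inside; outside; _⊆_; _∩_; _∪_; ⊥; ⊤; Nonempty; ∣_∣)
import Data.Fin.Subset.Properties as SP
open import Data.Vec using ([]; _∷_; here; there)
open import Data.Bool using (if_then_else_)
open import Data.Sum using (_⊎_; inj₁; inj₂)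
open import Data.Product using (∃; _×_; _,_; proj₁; proj₂)
open import Data.Unit using (tt) renaming (⊤ to Unit)
open import Data.Empty using (⊥-elim) renaming (⊥ to Empty)
open import Function using (_∘_; _⇔_; mk⇔; Equivalence)
open import Function.Properties.Equivalence using () renaming (trans to ⇔-trans)
open import Relation.Binary.Definitions using (Antitonic₁)
open import Relation.Binary.PropositionalEquality
open import Relation.Nullary using (yes; no; does; contradiction)
open import Relation.Unary using (Pred; Decidable)

infix  4 _≤∞_
infixl 6 _+∞_ _⊔∞_

_≤∞_ : ℤ∞ → ℤ∞ → Set
-∞    ≤∞ y     = Unit
fin a ≤∞ -∞    = Empty
fin a ≤∞ fin b = a ≤ b

≤∞-refl : ∀ x → x ≤∞ x
≤∞-refl -∞      = tt
≤∞-refl (fin a) = ℤP.≤-refl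

≤∞-trans : ∀ x {y z} → x ≤∞ y → y ≤∞ z → x ≤∞ z
≤∞-trans -∞      _ _ = tt
≤∞-trans (fin a) {fin b} {fin c} a≤b b≤c = ℤP.≤-trans a≤b b≤c

≤∞-reflexive : ∀ {x y} → x ≡ y → x ≤∞ y
≤∞-reflexive {x} refl = ≤∞-refl x

≤∞-antisym : ∀ x y → x ≤∞ y → y ≤∞ x → x ≡ y
≤∞-antisym -∞      -∞      _   _   = refl
≤∞-antisym (fin a) (fin b) a≤b b≤a = cong fin (ℤP.≤-antisym a≤b b≤a)

≤∞-fin⇒≥∞ : ∀ x {b} → x ≤∞ fin b → b ≥∞ x
≤∞-fin⇒≥∞ -∞      _ = tt
≤∞-fin⇒≥∞ (fin a) h = h

≥∞⇒≤∞-fin : ∀ x {b} → b ≥∞ x → x ≤∞ fin b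
≥∞⇒≤∞-fin -∞      _ = tt
≥∞⇒≤∞-fin (fin a) h = h

≥∞-weaken : ∀ x {a b} → a ≤ b → a ≥∞ x → b ≥∞ x
≥∞-weaken -∞      _   _ = tt
≥∞-weaken (fin c) a≤b c≤a = ℤP.≤-trans c≤a a≤b

-- junk value at -∞; only applied to finite arguments
toℤ : ℤ∞ → ℤ
toℤ -∞      = + 0
toℤ (fin a) = a

fin-toℤ : ∀ {a} x → fin a ≤∞ x → fin (toℤ x) ≡ x
fin-toℤ (fin b) _ = refl

fin-injective : ∀ {a b} → fin a ≡ fin b → a ≡ b
fin-injective refl = refl

_+∞_ : ℤ∞ → ℤ∞ → ℤ∞
-∞    +∞ y     = -∞
fin a +∞ -∞    = -∞
fin a +∞ fin b = fin (a + b)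

+∞-mono-≤∞ : ∀ x {x′ y y′} → x ≤∞ x′ → y ≤∞ y′ → x +∞ y ≤∞ x′ +∞ y′
+∞-mono-≤∞ -∞      _ _ = tt
+∞-mono-≤∞ (fin a) {fin a′} { -∞}    _   _   = tt
+∞-mono-≤∞ (fin a) {fin a′} {fin b} {fin b′} a≤a′ b≤b′ = ℤP.+-mono-≤ a≤a′ b≤b′

+∞-interchange : ∀ w x y z → (w +∞ x) +∞ (y +∞ z) ≡ (w +∞ y) +∞ (x +∞ z)
+∞-interchange -∞      _       _       _       = refl
+∞-interchange (fin w) -∞      -∞      _       = refl
+∞-interchange (fin w) -∞      (fin y) _       = refl
+∞-interchange (fin w) (fin x) -∞      _       = refl
+∞-interchange (fin w) (fin x) (fin y) -∞      = refl
+∞-interchange (fin w) (fin x) (fin y) (fin z) = cong fin (+-interchange w x y z)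

+∞-inverse : ∀ x a b → a + b ≡ + 0 → x +∞ fin a +∞ fin b ≡ x
+∞-inverse -∞      a b _        = refl
+∞-inverse (fin c) a b a+b≡0 = cong fin (trans (ℤP.+-assoc c a b)
                                 (trans (cong (λ t → c + t) a+b≡0) (ℤP.+-identityʳ c)))

_⊔∞_ : ℤ∞ → ℤ∞ → ℤ∞
-∞    ⊔∞ y     = y
fin a ⊔∞ -∞    = fin a
fin a ⊔∞ fin b = fin (a ⊔ b)

⊔∞-upperˡ : ∀ x y → x ≤∞ x ⊔∞ y
⊔∞-upperˡ -∞      _       = tt
⊔∞-upperˡ (fin a) -∞      = ℤP.≤-refl
⊔∞-upperˡ (fin a) (fin b) = ℤP.i≤i⊔j a b

⊔∞-upperʳ : ∀ x y → y ≤∞ x ⊔∞ y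
⊔∞-upperʳ -∞      y       = ≤∞-refl y
⊔∞-upperʳ (fin a) -∞      = tt
⊔∞-upperʳ (fin a) (fin b) = ℤP.i≤j⊔i a b

⊔∞-sel : ∀ x y → x ⊔∞ y ≡ x ⊎ x ⊔∞ y ≡ y
⊔∞-sel -∞      y       = inj₂ refl
⊔∞-sel (fin a) -∞      = inj₁ refl
⊔∞-sel (fin a) (fin b) with ℤP.⊔-sel a b
... | inj₁ e = inj₁ (cong fin e)
... | inj₂ e = inj₂ (cong fin e)

⨆ : ∀ {n} → (Subset n → ℤ∞) → ℤ∞
⨆ {zero}  h = h []
⨆ {suc n} h = ⨆ (h ∘ (outside ∷_)) ⊔∞ ⨆ (h ∘ (inside ∷_))

⨆-upper : ∀ {n} (h : Subset n → ℤ∞) W → h W ≤∞ ⨆ h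
⨆-upper h []            = ≤∞-refl (h [])
⨆-upper h (outside ∷ W) =
  ≤∞-trans (h (outside ∷ W)) (⨆-upper (h ∘ (outside ∷_)) W) (⊔∞-upperˡ _ _)
⨆-upper h (inside ∷ W)  =
  ≤∞-trans (h (inside ∷ W)) (⨆-upper (h ∘ (inside ∷_)) W) (⊔∞-upperʳ _ _)

⨆-attained : ∀ {n} (h : Subset n → ℤ∞) → ∃ λ W → ⨆ h ≡ h W
⨆-attained {zero}  h = [] , refl
⨆-attained {suc n} h with ⊔∞-sel (⨆ (h ∘ (outside ∷_))) (⨆ (h ∘ (inside ∷_)))
... | inj₁ e = let W , e′ = ⨆-attained (h ∘ (outside ∷_)) in outside ∷ W , trans e e′
... | inj₂ e = let W , e′ = ⨆-attained (h ∘ (inside ∷_))  in inside ∷ W , trans e e′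

module _ {n ℓ} {P : Pred (Subset n) ℓ} (P? : Decidable P) (h : Subset n → ℤ∞) where

  maxOn : ℤ∞
  maxOn = ⨆ λ W → if does (P? W) then h W else -∞

  maxOn-upper : ∀ {W} → P W → h W ≤∞ maxOn
  maxOn-upper {W} w with P? W | ⨆-upper (λ W → if does (P? W) then h W else -∞) W
  ... | yes _ | ub = ub
  ... | no ¬w | _  = contradiction w ¬w

  maxOn-attained : ∀ {a} → maxOn ≡ fin a → ∃ λ W → P W × h W ≡ fin a
  maxOn-attained e with ⨆-attained (λ W → if does (P? W) then h W else -∞)
  ... | W , e′ with P? W
  ...   | yes w = W , w , trans (sym e′) e
  ...   | no _  with () ← trans (sym e′) e

  maxOn-finite : ∀ {W a} → P W → h W ≡ fin a →
    ∃ λ b → (∃ λ W → P W × h W ≡ fin b) × (∀ {W} → P W → h W ≤∞ fin b)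
  maxOn-finite {W} w hW≡a with maxOn in e
  ... | -∞    = ⊥-elim (subst₂ _≤∞_ hW≡a e (maxOn-upper w))
  ... | fin b = b , maxOn-attained e , λ w′ → subst (_ ≤∞_) e (maxOn-upper w′)

  maxOn-least : ∀ {x} → (∀ {W} → P W → h W ≤∞ x) → maxOn ≤∞ x
  maxOn-least {x} bound with maxOn in e
  ... | -∞    = tt
  ... | fin a with maxOn-attained e
  ...   | W , w , hW = subst (_≤∞ x) hW (bound w)

Supermodular : ∀ {n} → (Subset n → ℤ∞) → Set
Supermodular h = ∀ X Y → h X +∞ h Y ≤∞ h (X ∩ Y) +∞ h (X ∪ Y)

Modular : ∀ {n} → (Subset n → ℤ) → Set
Modular m = ∀ X Y → m X + m Y ≡ m (X ∩ Y) + m (X ∪ Y)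

supermodular-resp : ∀ {n} {h h′ : Subset n → ℤ∞} →
  (∀ X → h X ≡ h′ X) → Supermodular h → Supermodular h′
supermodular-resp {h = h} {h′} h≗h′ sm X Y =
  subst₂ _≤∞_ (cong₂ _+∞_ (h≗h′ X) (h≗h′ Y)) (cong₂ _+∞_ (h≗h′ (X ∩ Y)) (h≗h′ (X ∪ Y))) (sm X Y)

supermodular-+modular : ∀ {n} {h : Subset n → ℤ∞} {m : Subset n → ℤ} →
  Supermodular h → Modular m → Supermodular (λ X → h X +∞ fin (m X))
supermodular-+modular {h = h} {m} sm mod X Y =
  subst₂ _≤∞_ (sym (+∞-interchange (h X) (fin (m X)) (h Y) (fin (m Y))))
              (sym (+∞-interchange (h (X ∩ Y)) (fin (m (X ∩ Y))) (h (X ∪ Y)) (fin (m (X ∪ Y)))))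
    (+∞-mono-≤∞ (h X +∞ h Y) (sm X Y) (ℤP.≤-reflexive (mod X Y)))

admissible⇒supermodular : ∀ {n} {p : Subset n → ℤ∞} → Admissible p → Supermodular p
admissible⇒supermodular {p = p} adm X Y with p X in eX | p Y in eY
... | -∞    | _     = tt
... | fin a | -∞    = tt
... | fin a | fin b with Admissible.supermodular adm X Y a b eX eY
...   | c , d , e∩ , e∪ , a+b≤c+d rewrite e∩ | e∪ = a+b≤c+d

∣∩∣+∣∪∣≡∣∣+∣∣ : ∀ {n} (X Y : Subset n) → ∣ X ∩ Y ∣ ℕ.+ ∣ X ∪ Y ∣ ≡ ∣ X ∣ ℕ.+ ∣ Y ∣
∣∩∣+∣∪∣≡∣∣+∣∣ []            []            = refl
∣∩∣+∣∪∣≡∣∣+∣∣ (inside  ∷ X) (inside  ∷ Y) =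
  cong suc (trans (ℕP.+-suc _ _) (trans (cong suc (∣∩∣+∣∪∣≡∣∣+∣∣ X Y)) (sym (ℕP.+-suc _ _))))
∣∩∣+∣∪∣≡∣∣+∣∣ (inside  ∷ X) (outside ∷ Y) = trans (ℕP.+-suc _ _) (cong suc (∣∩∣+∣∪∣≡∣∣+∣∣ X Y))
∣∩∣+∣∪∣≡∣∣+∣∣ (outside ∷ X) (inside  ∷ Y) =
  trans (ℕP.+-suc _ _) (trans (cong suc (∣∩∣+∣∪∣≡∣∣+∣∣ X Y)) (sym (ℕP.+-suc _ _)))
∣∩∣+∣∪∣≡∣∣+∣∣ (outside ∷ X) (outside ∷ Y) = ∣∩∣+∣∪∣≡∣∣+∣∣ X Y

scaledCard-modular : ∀ {n} c → Modular {n} (λ X → c * + ∣ X ∣)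
scaledCard-modular c X Y = begin
  c * + ∣ X ∣ + c * + ∣ Y ∣           ≡⟨ ℤP.*-distribˡ-+ c (+ ∣ X ∣) (+ ∣ Y ∣) ⟨
  c * (+ ∣ X ∣ + + ∣ Y ∣)             ≡⟨ cong (c *_) (ℤP.pos-+ ∣ X ∣ ∣ Y ∣) ⟨
  c * + (∣ X ∣ ℕ.+ ∣ Y ∣)             ≡⟨ cong (λ k → c * + k) (∣∩∣+∣∪∣≡∣∣+∣∣ X Y) ⟨
  c * + (∣ X ∩ Y ∣ ℕ.+ ∣ X ∪ Y ∣)     ≡⟨ cong (c *_) (ℤP.pos-+ ∣ X ∩ Y ∣ ∣ X ∪ Y ∣) ⟩
  c * (+ ∣ X ∩ Y ∣ + + ∣ X ∪ Y ∣)     ≡⟨ ℤP.*-distribˡ-+ c (+ ∣ X ∩ Y ∣) (+ ∣ X ∪ Y ∣) ⟩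
  c * + ∣ X ∩ Y ∣ + c * + ∣ X ∪ Y ∣   ∎
  where open ≡-Reasoning

∩-mono-⊆ : ∀ {n} {X X′ Y Y′ : Subset n} → X ⊆ X′ → Y ⊆ Y′ → X ∩ Y ⊆ X′ ∩ Y′
∩-mono-⊆ {X = X} {Y = Y} X⊆X′ Y⊆Y′ x∈X∩Y =
  let x∈X , x∈Y = SP.x∈p∩q⁻ X Y x∈X∩Y in SP.x∈p∩q⁺ (X⊆X′ x∈X , Y⊆Y′ x∈Y)

∪-mono-⊆ : ∀ {n} {X X′ Y Y′ : Subset n} → X ⊆ X′ → Y ⊆ Y′ → X ∪ Y ⊆ X′ ∪ Y′
∪-mono-⊆ {X = X} {Y = Y} X⊆X′ Y⊆Y′ x∈X∪Y with SP.x∈p∪q⁻ X Y x∈X∪Y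
... | inj₁ x∈X = SP.x∈p∪q⁺ (inj₁ (X⊆X′ x∈X))
... | inj₂ x∈Y = SP.x∈p∪q⁺ (inj₂ (Y⊆Y′ x∈Y))

module _ {n} (h : Subset n → ℤ∞) where

  maxAbove : Subset n → ℤ∞
  maxAbove X = maxOn (X SP.⊆?_) h

  maxAbove-upper : ∀ {X W} → X ⊆ W → h W ≤∞ maxAbove X
  maxAbove-upper {X} = maxOn-upper (X SP.⊆?_) h

  maxAbove-antitone : Antitonic₁ _⊆_ _≤∞_ maxAbove
  maxAbove-antitone {X} {Y} Y⊆X =
    maxOn-least (X SP.⊆?_) h λ X⊆W → maxAbove-upper (SP.⊆-trans Y⊆X X⊆W)

  maxAbove-⊤ : maxAbove ⊤ ≡ h ⊤
  maxAbove-⊤ = ≤∞-antisym _ _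
    (maxOn-least (⊤ SP.⊆?_) h λ ⊤⊆W → ≤∞-reflexive (cong h (SP.⊆-antisym SP.⊆⊤ ⊤⊆W)))
    (maxAbove-upper SP.⊆-refl)

  maxAbove-supermodular : Supermodular h → Supermodular maxAbove
  maxAbove-supermodular sm X Y with maxAbove X in eX | maxAbove Y in eY
  ... | -∞    | _     = tt
  ... | fin a | -∞    = tt
  ... | fin a | fin b with maxOn-attained (X SP.⊆?_) h eX | maxOn-attained (Y SP.⊆?_) h eY
  ... | W , X⊆W , hW | W′ , Y⊆W′ , hW′ =
    ≤∞-trans (fin (a + b)) (subst₂ (λ u v → u +∞ v ≤∞ h (W ∩ W′) +∞ h (W ∪ W′)) hW hW′ (sm W W′))
      (+∞-mono-≤∞ (h (W ∩ W′)) (maxAbove-upper (∩-mono-⊆ X⊆W Y⊆W′))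
                               (maxAbove-upper (∪-mono-⊆ X⊆W Y⊆W′)))

≤-translate : ∀ {x y x′ y′} k → x + k ≡ x′ → y + k ≡ y′ → x ≤ y → x′ ≤ y′
≤-translate k ex ey x≤y = subst₂ _≤_ ex ey (ℤP.+-monoˡ-≤ k x≤y)

suc-step : ∀ x β k → x - β * + suc k + β ≡ x - β * + k
suc-step x β k = trans (cong (λ t → x - β * t + β) (ℤP.pos-+ 1 k)) (unfold x β (+ k))
  where
  unfold : ∀ x β k → x - β * (+ 1 + k) + β ≡ x - β * k
  unfold = solve-∀

telescope : ∀ a b c → (b - a) + (c - b) ≡ c - a
telescope a b c = trans (ℤP.+-comm (b - a) (c - b)) (ℤP.+-minus-telescope c b a)

-- the increments of q along the chain {0} ⊂ {0,1} ⊂ ⋯ ⊂ S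
greedy : ∀ {n} → (Subset n → ℤ) → Fin n → ℤ
greedy {suc n} q zero    = q (inside ∷ ⊥) - q (outside ∷ ⊥)
greedy {suc n} q (suc i) = greedy (q ∘ (inside ∷_)) i

greedy-sum-⊤ : ∀ {n} (q : Subset n → ℤ) → sumOver ⊤ (greedy q) ≡ q ⊤ - q ⊥
greedy-sum-⊤ {zero}  q = sym (ℤP.+-inverseʳ (q []))
greedy-sum-⊤ {suc n} q = begin
  (q (inside ∷ ⊥) - q (outside ∷ ⊥)) + sumOver ⊤ (greedy (q ∘ (inside ∷_)))
    ≡⟨ cong (λ t → greedy q zero + t) (greedy-sum-⊤ (q ∘ (inside ∷_))) ⟩
  (q (inside ∷ ⊥) - q (outside ∷ ⊥)) + (q (inside ∷ ⊤) - q (inside ∷ ⊥))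
    ≡⟨ telescope (q (outside ∷ ⊥)) (q (inside ∷ ⊥)) (q (inside ∷ ⊤)) ⟩
  q (inside ∷ ⊤) - q (outside ∷ ⊥) ∎
  where open ≡-Reasoning

supermodular-inside∷ : ∀ {n} {h : Subset (suc n) → ℤ∞} →
  Supermodular h → Supermodular (h ∘ (inside ∷_))
supermodular-inside∷ sm X Y = sm (inside ∷ X) (inside ∷ Y)

greedy-sum-≥ : ∀ {n} (q : Subset n → ℤ) → Supermodular (fin ∘ q) →
  ∀ Z → q Z - q ⊥ ≤ sumOver Z (greedy q)
greedy-sum-≥ {zero}  q sm [] = ℤP.≤-reflexive (ℤP.+-inverseʳ (q []))
greedy-sum-≥ {suc n} q sm (inside ∷ Z) = begin
  q (inside ∷ Z) - q (outside ∷ ⊥)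
    ≡⟨ telescope (q (outside ∷ ⊥)) (q (inside ∷ ⊥)) (q (inside ∷ Z)) ⟨
  (q (inside ∷ ⊥) - q (outside ∷ ⊥)) + (q (inside ∷ Z) - q (inside ∷ ⊥))
    ≤⟨ ℤP.+-monoʳ-≤ (greedy q zero) ih ⟩
  (q (inside ∷ ⊥) - q (outside ∷ ⊥)) + sumOver Z (greedy (q ∘ (inside ∷_))) ∎
  where
  open ℤP.≤-Reasoning
  ih : q (inside ∷ Z) - q (inside ∷ ⊥) ≤ sumOver Z (greedy (q ∘ (inside ∷_)))
  ih = greedy-sum-≥ (q ∘ (inside ∷_)) (supermodular-inside∷ {h = fin ∘ q} sm) Z
greedy-sum-≥ {suc n} q sm (outside ∷ Z) = begin
  q (outside ∷ Z) - q (outside ∷ ⊥)   ≤⟨ exchange ⟩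
  q (inside ∷ Z) - q (inside ∷ ⊥)     ≤⟨ ih ⟩
  sumOver Z (greedy (q ∘ (inside ∷_))) ≡⟨ ℤP.+-identityˡ _ ⟨
  + 0 + sumOver Z (greedy (q ∘ (inside ∷_))) ∎
  where
  open ℤP.≤-Reasoning
  ih : q (inside ∷ Z) - q (inside ∷ ⊥) ≤ sumOver Z (greedy (q ∘ (inside ∷_)))
  ih = greedy-sum-≥ (q ∘ (inside ∷_)) (supermodular-inside∷ {h = fin ∘ q} sm) Z
  a b c d : ℤ
  a = q (outside ∷ Z); b = q (inside ∷ ⊥); c = q (outside ∷ ⊥); d = q (inside ∷ Z)
  a+b≤c+d : a + b ≤ c + d
  a+b≤c+d = subst₂ (λ U V → a + b ≤ q (outside ∷ U) + q (inside ∷ V))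
              (SP.∩-zeroʳ Z) (SP.∪-identityʳ Z) (sm (outside ∷ Z) (inside ∷ ⊥))
  exchange : a - c ≤ d - b
  exchange = ≤-translate (- c - b) (left a b c) (right c d b) a+b≤c+d
    where
    left : ∀ a b c → a + b + (- c - b) ≡ a - c
    left = solve-∀
    right : ∀ c d b → c + d + (- c - b) ≡ d - b
    right = solve-∀

greedy-≤ : ∀ {n} (q : Subset n → ℤ) β → Antitonic₁ _⊆_ _≤_ (λ X → q X - β * + ∣ X ∣) →
  ∀ i → greedy q i ≤ β
greedy-≤ {suc n} q β anti zero =
  ≤-translate (c - v) (cancelˡ u v c) (cancelʳ v c β)
    (≤-translate β (suc-step u β ∣ ⊥ {n} ∣) refl (anti (SP.out⊆ (SP.⊆-refl {x = ⊥}))))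
  where
  u v c : ℤ
  u = q (inside ∷ ⊥); v = q (outside ∷ ⊥); c = β * + ∣ ⊥ {n} ∣
  cancelˡ : ∀ u v c → u - c + (c - v) ≡ u - v
  cancelˡ = solve-∀
  cancelʳ : ∀ v c β → v - c + β + (c - v) ≡ β
  cancelʳ = solve-∀
greedy-≤ {suc n} q β anti (suc i) = greedy-≤ (q ∘ (inside ∷_)) β anti′ i
  where
  anti′ : Antitonic₁ _⊆_ _≤_ (λ X → q (inside ∷ X) - β * + ∣ X ∣)
  anti′ {X} {Y} Y⊆X =
    ≤-translate β (suc-step (q (inside ∷ X)) β ∣ X ∣) (suc-step (q (inside ∷ Y)) β ∣ Y ∣)
      (anti (SP.in⊆in Y⊆X))

≤-/ℕ⇔ : ∀ c b k → c ≤ b /ℕ suc k ⇔ c * + suc k ≤ b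
≤-/ℕ⇔ c b k = mk⇔
  (λ c≤b/d → ℤP.≤-trans (ℤP.*-monoʳ-≤-nonNeg (+ suc k) c≤b/d) (ℤDM.[n/ℕd]*d≤n b (suc k)))
  (λ cd≤b → subst (c ≤_) (ℤP.pred-suc (b /ℕ suc k))
     (ℤP.i<j⇒i≤pred[j] (ℤP.*-cancelʳ-<-nonNeg {j = ℤ.suc (b /ℕ suc k)} (+ suc k)
       (ℤP.≤-<-trans cd≤b (ℤDM.n<s[n/ℕd]*d b (suc k))))))

neg-≤-neg⇔ : ∀ x y → - x ≤ - y ⇔ y ≤ x
neg-≤-neg⇔ x y = mk⇔ ℤP.neg-cancel-≤ ℤP.neg-mono-≤

neg-≤-swap⇔ : ∀ x y → - x ≤ y ⇔ - y ≤ x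
neg-≤-swap⇔ x y = mk⇔
  (λ -x≤y → subst (- y ≤_) (ℤP.neg-involutive x) (ℤP.neg-mono-≤ -x≤y))
  (λ -y≤x → subst (- x ≤_) (ℤP.neg-involutive y) (ℤP.neg-mono-≤ -y≤x))

ceilDiv≤⇔ : ∀ a k c → ceilDiv a (suc k) ≤ c ⇔ a ≤ c * + suc k
ceilDiv≤⇔ a k c =
  ⇔-trans (neg-≤-swap⇔ ((- a) /ℕ suc k) c)
  (⇔-trans (≤-/ℕ⇔ (- c) (- a) k)
           (subst (λ t → t ≤ - a ⇔ a ≤ c * + suc k) (ℤP.neg-distribˡ-* c (+ suc k))
                  (neg-≤-neg⇔ (c * + suc k) a)))

sumOver-≤ : ∀ {n} {z : Fin n → ℤ} {c} → (∀ s → z s ≤ c) → ∀ X → sumOver X z ≤ c * + ∣ X ∣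
sumOver-≤ {c = c} z≤c [] = ℤP.≤-reflexive (sym (ℤP.*-zeroʳ c))
sumOver-≤ {z = z} {c} z≤c (inside ∷ X) = begin
  z zero + sumOver X (z ∘ suc)   ≤⟨ ℤP.+-mono-≤ (z≤c zero) (sumOver-≤ (z≤c ∘ suc) X) ⟩
  c + c * + ∣ X ∣                ≡⟨ ℤP.*-suc c (+ ∣ X ∣) ⟨
  c * + suc ∣ X ∣                ∎
  where open ℤP.≤-Reasoning
sumOver-≤ {z = z} z≤c (outside ∷ X) =
  subst (_≤ _) (sym (ℤP.+-identityˡ _)) (sumOver-≤ (z≤c ∘ suc) X)

nonempty⇒∣∣≡suc : ∀ {n} (X : Subset n) → Nonempty X → ∃ λ k → ∣ X ∣ ≡ suc k
nonempty⇒∣∣≡suc (inside  ∷ X) _                  = ∣ X ∣ , refl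
nonempty⇒∣∣≡suc (outside ∷ X) (suc x , there x∈X) = nonempty⇒∣∣≡suc X (x , x∈X)

ceilRatio-≤⇔ : ∀ {n} (p : Subset n → ℤ∞) {X} c → Nonempty X →
  c ≥∞ ceilRatio p X ⇔ (c * + ∣ X ∣) ≥∞ p X
ceilRatio-≤⇔ p {X} c ne with nonempty⇒∣∣≡suc X ne | p X
... | k , ∣X∣≡1+k | -∞    = mk⇔ (λ _ → tt) (λ _ → tt)
... | k , ∣X∣≡1+k | fin a rewrite ∣X∣≡1+k = ceilDiv≤⇔ a k c

ceilRatio-fin : ∀ {n} (p : Subset n → ℤ∞) {X a} →
  p X ≡ fin a → ceilRatio p X ≡ fin (ceilDiv a ∣ X ∣)
ceilRatio-fin p {X} pX≡a with p X
... | fin _ = cong (λ b → fin (ceilDiv b ∣ X ∣)) (fin-injective pX≡a)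

maxRatio-exists : ∀ {m} (p : Subset (suc m) → ℤ∞) → ∃ (λ c → p ⊤ ≡ fin c) → ∃ (IsMaxRatio p)
maxRatio-exists p (c , p⊤≡c) =
  let β , attained , upper =
        maxOn-finite SP.nonempty? (ceilRatio p) (zero , here) (ceilRatio-fin p p⊤≡c)
  in β , attained , λ X ne → ≤∞-fin⇒≥∞ (ceilRatio p X) (upper ne)

ratioBound⇒densityBound : ∀ {n} {p : Subset n → ℤ∞} {c} → p ⊥ ≡ fin (+ 0) →
  (∀ X → Nonempty X → c ≥∞ ceilRatio p X) → ∀ X → (c * + ∣ X ∣) ≥∞ p X
ratioBound⇒densityBound {n} {p} {c} p⊥≡0 bound X with SP.nonempty? X
... | yes ne  = Equivalence.to (ceilRatio-≤⇔ p c ne) (bound X ne)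
... | no ¬ne rewrite SP.Empty-unique ¬ne | p⊥≡0 | SP.∣⊥∣≡0 n = ℤP.≤-reflexive (sym (ℤP.*-zeroʳ c))

maxRatio-≤ : ∀ {n} {p : Subset n → ℤ∞} {β c} → IsMaxRatio p β →
  (∀ X → (c * + ∣ X ∣) ≥∞ p X) → β ≤ c
maxRatio-≤ {p = p} {c = c} ((X , ne , ratio≡β) , _) bound =
  subst (c ≥∞_) ratio≡β (Equivalence.from (ceilRatio-≤⇔ p c ne) (bound X))

module _ {n} {p : Subset n → ℤ∞} (adm : Admissible p) {β : ℤ}
         (p≤β∣∣ : ∀ X → (β * + ∣ X ∣) ≥∞ p X) where

  open Admissible adm

  private
    slack : Subset n → ℤ∞
    slack W = p W +∞ fin (- β * + ∣ W ∣)

    f : Subset n → ℤ∞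
    f = maxAbove slack

    q : Subset n → ℤ
    q X = toℤ (f X) + β * + ∣ X ∣

    p≡slack+β∣∣ : ∀ X → p X ≡ slack X +∞ fin (β * + ∣ X ∣)
    p≡slack+β∣∣ X = sym (+∞-inverse (p X) (- β * + ∣ X ∣) (β * + ∣ X ∣) (cancel β (+ ∣ X ∣)))
      where
      cancel : ∀ β k → - β * k + β * k ≡ + 0
      cancel = solve-∀

    slack≤0 : ∀ W → slack W ≤∞ fin (+ 0)
    slack≤0 W = subst (slack W ≤∞_) (cong fin (cancel β (+ ∣ W ∣)))
      (+∞-mono-≤∞ (p W) (≥∞⇒≤∞-fin (p W) (p≤β∣∣ W)) (ℤP.≤-refl { - β * + ∣ W ∣}))
      where
      cancel : ∀ β k → β * k + - β * k ≡ + 0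
      cancel = solve-∀

    f-finite : ∀ X → fin (toℤ (f X)) ≡ f X
    f-finite X = fin-toℤ (f X) (subst (_≤∞ f X) slack-⊤ (maxAbove-upper slack {X} SP.⊆⊤))
      where
      slack-⊤ : slack ⊤ ≡ fin (proj₁ p-S-finite + - β * + ∣ ⊤ {n} ∣)
      slack-⊤ = cong (_+∞ fin (- β * + ∣ ⊤ {n} ∣)) (proj₂ p-S-finite)

    fin-q : ∀ X → fin (q X) ≡ f X +∞ fin (β * + ∣ X ∣)
    fin-q X = cong (_+∞ fin (β * + ∣ X ∣)) (f-finite X)

    q-supermodular : Supermodular (fin ∘ q)
    q-supermodular = supermodular-resp (sym ∘ fin-q)
      (supermodular-+modular
        (maxAbove-supermodular slack
          (supermodular-+modular (admissible⇒supermodular adm) (scaledCard-modular (- β))))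
        (scaledCard-modular β))

    q-excess-antitone : Antitonic₁ _⊆_ _≤_ (λ X → q X - β * + ∣ X ∣)
    q-excess-antitone {X} {Y} Y⊆X =
      subst₂ _≤_ (sym (cancel (toℤ (f X)) (β * + ∣ X ∣))) (sym (cancel (toℤ (f Y)) (β * + ∣ Y ∣)))
        (subst₂ _≤∞_ (sym (f-finite X)) (sym (f-finite Y)) (maxAbove-antitone slack Y⊆X))
      where
      cancel : ∀ a b → a + b - b ≡ a
      cancel = solve-∀

    p≤q : ∀ X → q X ≥∞ p X
    p≤q X = ≤∞-fin⇒≥∞ (p X) (subst₂ _≤∞_ (sym (p≡slack+β∣∣ X)) (sym (fin-q X))
      (+∞-mono-≤∞ (slack X) (maxAbove-upper slack {X} SP.⊆-refl) (ℤP.≤-refl {β * + ∣ X ∣})))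

    q-⊥ : q ⊥ ≡ + 0
    q-⊥ = begin
      toℤ (f ⊥) + β * + ∣ ⊥ {n} ∣ ≡⟨ cong₂ (λ a k → toℤ a + β * + k) f-⊥ (SP.∣⊥∣≡0 n) ⟩
      + 0 + β * + 0               ≡⟨ zero-sum β ⟩
      + 0                         ∎
      where
      open ≡-Reasoning
      zero-sum : ∀ β → + 0 + β * + 0 ≡ + 0
      zero-sum = solve-∀
      slack-⊥ : slack ⊥ ≡ fin (+ 0)
      slack-⊥ = trans (cong₂ (λ u k → u +∞ fin (- β * + k)) p-empty (SP.∣⊥∣≡0 n))
                      (cong fin (zero-sum (- β)))
      f-⊥ : f ⊥ ≡ fin (+ 0)
      f-⊥ = ≤∞-antisym (f ⊥) (fin (+ 0))
        (maxOn-least (⊥ SP.⊆?_) slack (λ {W} _ → slack≤0 W))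
        (subst (_≤∞ f ⊥) slack-⊥ (maxAbove-upper slack {⊥} SP.⊆-refl))

    q-⊤ : fin (q ⊤) ≡ p ⊤
    q-⊤ = trans (fin-q ⊤) (trans (cong (_+∞ fin (β * + ∣ ⊤ {n} ∣)) (maxAbove-⊤ slack))
                                (sym (p≡slack+β∣∣ ⊤)))

  boundedBasePoint : ∃ λ z → InB'ℤ p z × (∀ s → z s ≤ β)
  boundedBasePoint = greedy q , (total , lower) , greedy-≤ q β q-excess-antitone
    where
    sum-q : ∀ Z → q Z - q ⊥ ≡ q Z
    sum-q Z = trans (cong (λ t → q Z - t) q-⊥) (ℤP.+-identityʳ (q Z))
    total : p ⊤ ≡ fin (sumOver ⊤ (greedy q))
    total = trans (sym q-⊤) (cong fin (trans (sym (sum-q ⊤)) (sym (greedy-sum-⊤ q))))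
    lower : ∀ Z → sumOver Z (greedy q) ≥∞ p Z
    lower Z = ≥∞-weaken (p Z)
      (subst (_≤ sumOver Z (greedy q)) (sum-q Z) (greedy-sum-≥ q q-supermodular Z)) (p≤q Z)

maxRatio-≤-maxComp : ∀ {n} {p : Subset n → ℤ∞} {β γ} {z : Fin n → ℤ} →
  IsMaxRatio p β → InB'ℤ p z → (∀ s → z s ≤ γ) → β ≤ γ
maxRatio-≤-maxComp {p = p} maxRatio (_ , z≥p) z≤γ =
  maxRatio-≤ maxRatio λ X → ≥∞-weaken (p X) (sumOver-≤ z≤γ X) (z≥p X)

leastUpperBound⇒IsMaxComp : ∀ {n} (z : Fin n → ℤ) {β} →
  (∀ s → z s ≤ β) → (∀ γ → (∀ s → z s ≤ γ) → β ≤ γ) → IsMaxComp z β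
leastUpperBound⇒IsMaxComp z {β} z≤β least with FinP.any? (λ s → z s ℤ.≟ β)
... | yes attained = z≤β , attained
... | no ¬attained = ⊥-elim (ℤP.<-irrefl refl (ℤP.i≤pred[j]⇒i<j (least (ℤ.pred β) z<β)))
  where
  z<β : ∀ s → z s ≤ ℤ.pred β
  z<β s = ℤP.i<j⇒i≤pred[j] (ℤP.≤∧≢⇒< (z≤β s) (λ zs≡β → ¬attained (s , zs≡β)))

theorem4p1 : (m : ℕ) (p : Subset (suc m) → ℤ∞) → Admissible p →
    ∃ λ (β₁ : ℤ) → IsMinMaxComp p β₁ × IsMaxRatio p β₁
theorem4p1 m p adm =
  let open Admissible adm
      β , maxRatio  = maxRatio-exists p p-S-finite
      z , z∈B , z≤β = boundedBasePoint adm (ratioBound⇒densityBound p-empty (proj₂ maxRatio))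
  in β , ( (z , z∈B , leastUpperBound⇒IsMaxComp z z≤β (λ γ → maxRatio-≤-maxComp maxRatio z∈B))
         , (λ z′ γ z′∈B → maxRatio-≤-maxComp maxRatio z′∈B ∘ proj₁) )
       , maxRatio
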